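{- Let $k$ be an even positive integer, let $s,\tilde s,f$ be horizontal dominoes, $\varphi$ a vertical domino with upper entry $\delta$, and $b_0,b_1,\dots,b_k,b_w,b'_w$ blocks, all with entries in a commutative ring, such that $h_-(b_w)=s$ and $h_+(b'_w)=f$. Then \[ \det(s b_1\cdots b_k b'_w\varphi)\det(\tilde s b_0 b_w b_1\cdots b_k f)-\det(s b_1\cdots b_k f)\det(\tilde s b_0 b_w b_1\cdots b_k b'_w\varphi) =\det\begin{bmatrix} h_-(b_0)\\ \tilde s\end{bmatrix}\cdot\det b_w\cdot\det b'_w\cdot\delta\cdot\prod_{i=1}^k\det b_i. \]
   Context: A horizontal domino is a $1\times2$ matrix, a vertical domino a $2\times1$ matrix, a block a $2\times2$ matrix; $h_+(b),h_-(b)$ denote the top and bottom rows of a block $b$. For a sequence $X_0,\dots,X_n$ of dominoes and blocks, the DRH matrix $X_0X_1\cdots X_n$ is formed by placing the pieces successively as arrays of unit cells, each $X_t$ either directly above $X_{t-1}$ (left edges aligned) or directly to its right (bottom edges aligned), directions alternating and starting with "above" when $X_0$ is a horizontal domino; it is the bounding rectangle with the pieces' entries and $0$ elsewhere, rows read top to bottom, columns left to right (all matrices here are square). $\begin{bmatrix} u\\ u'\end{bmatrix}$ is the $2\times2$ matrix with top row $u$ and bottom row $u'$; determinants of blocks use their rows in top-to-bottom order. -}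

module Defs where

open import Algebra.Bundles using (CommutativeRing)
open import Data.Nat renaming (_+_ to _+ℕ_) using (ℕ; zero; suc; _∸_; _⊔_; _≤ᵇ_; _<ᵇ_)
open import Data.Bool using (Bool; true; false; if_then_else_; _∧_)
open import Data.Fin using (Fin; zero; suc; toℕ; punchIn)
open import Data.Product using (_×_; _,_; proj₁; proj₂)
open import Data.List using (List; []; _∷_; foldr)
open import Data.Vec using (Vec)
import Data.Vec as Vec

module DRH {c ℓ} (R : CommutativeRing c ℓ) where
  open CommutativeRing R using (Carrier; _≈_; _+_; _*_; -_; 0#; 1#)

  Matrix : ℕ → Set c
  Matrix n = Fin n → Fin n → Carrier

  sumFin : ∀ {n} → (Fin n → Carrier) → Carrier
  sumFin {zero}  f = 0#
  sumFin {suc n} f = f zero + sumFin (λ j → f (suc j))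

  alt : ℕ → Carrier → Carrier
  alt zero    x = x
  alt (suc m) x = - alt m x

  det : (n : ℕ) → Matrix n → Carrier
  det zero    A = 1#
  det (suc n) A =
    sumFin (λ j → alt (toℕ j) (A zero j * det n (λ i k → A (suc i) (punchIn j k))))

  HDom : Set c
  HDom = Carrier × Carrier

  -- vertical domino: (upper entry , lower entry)
  VDom : Set c
  VDom = Carrier × Carrier

  -- block: (top row , bottom row)
  Block : Set c
  Block = HDom × HDom

  h₊ : Block → HDom
  h₊ = proj₁

  h₋ : Block → HDom
  h₋ = proj₂

  stack : HDom → HDom → Block
  stack u u' = (u , u')

  _≈ₕ_ : HDom → HDom → Set ℓ
  (a , b) ≈ₕ (a' , b') = (a ≈ a') × (b ≈ b')

  blockMatrix : Block → Matrix 2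
  blockMatrix ((a , b) , (c' , d)) zero    zero       = a
  blockMatrix ((a , b) , (c' , d)) zero    (suc _)    = b
  blockMatrix ((a , b) , (c' , d)) (suc _) zero       = c'
  blockMatrix ((a , b) , (c' , d)) (suc _) (suc _)    = d

  detB : Block → Carrier
  detB b = det 2 (blockMatrix b)

  prodDet : ∀ {k} → Vec Block k → Carrier
  prodDet bs = Vec.foldr _ (λ b acc → detB b * acc) 1# bs

  data Piece : Set c where
    hd : HDom → Piece
    vd : VDom → Piece
    bl : Block → Piece

  wd : Piece → ℕ
  wd (hd _) = 2
  wd (vd _) = 1
  wd (bl _) = 2

  ht : Piece → ℕ
  ht (hd _) = 1
  ht (vd _) = 2
  ht (bl _) = 2

  -- entry of a piece at (row from top, column from left)
  cell : Piece → ℕ → ℕ → Carrier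
  cell (hd (a , b)) _ zero    = a
  cell (hd (a , b)) _ (suc _) = b
  cell (vd (a , b)) zero    _ = a
  cell (vd (a , b)) (suc _) _ = b
  cell (bl ((a , b) , (c' , d))) zero    zero    = a
  cell (bl ((a , b) , (c' , d))) zero    (suc _) = b
  cell (bl ((a , b) , (c' , d))) (suc _) zero    = c'
  cell (bl ((a , b) , (c' , d))) (suc _) (suc _) = d

  data Dir : Set where
    above right : Dir

  flipDir : Dir → Dir
  flipDir above = right
  flipDir right = above

  -- placed pieces: (x of left edge , y of bottom edge , piece), y measured upwards
  Placed : Set c
  Placed = ℕ × ℕ × Piece

  -- place d x y p rest : p has its lower-left corner at (x , y);
  -- the next piece is put in direction d relative to p, directions then alternate
  place : Dir → ℕ → ℕ → Piece → List Piece → List Placed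
  place d     x y p []       = (x , y , p) ∷ []
  place above x y p (q ∷ qs) = (x , y , p) ∷ place right x (y +ℕ ht p) q qs
  place right x y p (q ∷ qs) = (x , y , p) ∷ place above (x +ℕ wd p) y q qs

  startDir : Piece → Dir
  startDir (hd _) = above
  startDir (vd _) = right
  startDir (bl _) = right

  placeAll : List Piece → List Placed
  placeAll []       = []
  placeAll (p ∷ ps) = place (startDir p) 0 0 p ps

  width : List Piece → ℕ
  width ps = foldr (λ { (x , y , p) m → (x +ℕ wd p) ⊔ m }) 0 (placeAll ps)

  height : List Piece → ℕ
  height ps = foldr (λ { (x , y , p) m → (y +ℕ ht p) ⊔ m }) 0 (placeAll ps)

  lookupCell : List Placed → ℕ → ℕ → Carrier
  lookupCell []                  cy cx = 0#
  lookupCell ((x , y , p) ∷ rest) cy cx =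
    if (x ≤ᵇ cx) ∧ (cx <ᵇ x +ℕ wd p) ∧ (y ≤ᵇ cy) ∧ (cy <ᵇ y +ℕ ht p)
    then cell p (ht p ∸ suc (cy ∸ y)) (cx ∸ x)
    else lookupCell rest cy cx

  -- (r , c) entry of the DRH matrix X₀X₁⋯Xₙ, rows numbered from the top
  drhEntry : List Piece → ℕ → ℕ → Carrier
  drhEntry ps r cx = lookupCell (placeAll ps) (height ps ∸ suc r) cx

  -- the DRH matrix as an n×n matrix with n = its width (all DRH matrices here are square)
  drhMatrix : (ps : List Piece) → Matrix (width ps)
  drhMatrix ps i j = drhEntry ps (toℕ i) (toℕ j)

  detDRH : List Piece → Carrier
  detDRH ps = det (width ps) (drhMatrix ps)

-- Expanding along the top two rows, the determinant of a staircase s b₁ c₁ b₂ ⋯ cₘ bₘ₊₁ φ ending in a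
-- vertical domino is u · φ for a vector u determined by the preceding pieces, and appending a pair (c , b)
-- transforms u by a linear map of determinant det c · det b. A staircase ending in b f instead has
-- determinant f ∧ (u ⋆ b), with u ⋆ b the row vector u times the matrix b. The left-hand side is then a
-- two-dimensional Plücker relation: since f = h₊ b'w it equals -(u ⋆ bₖ ∧ ũ ⋆ bₖ) · det b'w · δ, and the
-- wedge of the two coefficient vectors u, ũ is the wedge of the initial ones times the product of the
-- block determinants; because h₋ bw = s, the initial wedge is -det [h₋ b₀ ; s̃] · det bw · det b₁.

module Submission where

open import Defs
open import Algebra.Bundles using (CommutativeRing)
open import Data.Bool using (Bool; true; false; T; _∧_)
open import Data.Bool.Properties using (∧-zeroʳ)
open import Data.Fin as Fin using (Fin; toℕ; punchIn)
import Data.Fin.Properties as Fin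
import Data.Integer as ℤ
import Data.Integer.Properties as ℤ
open import Data.List using (List; []; _∷_; _++_; _∷ʳ_; map; foldr)
import Data.List.Properties as List
open import Data.List.Relation.Unary.All as All using (All; []; _∷_)
open import Data.List.Relation.Unary.All.Properties using (++⁺)
open import Data.List.Relation.Unary.Any using (Any; here; there)
open import Data.List.Relation.Unary.Any.Properties using (++⁺ʳ)
open import Data.List.Reverse using (Reverse; []; _∶_∶ʳ_; reverseView)
open import Data.Maybe using (Maybe; just; nothing)
open import Data.Nat as ℕ using (ℕ; zero; suc; _∸_; _≤_; _<_; z≤n; s≤s; 2+; _<ᵇ_; _≤ᵇ_; _⊔_)
open import Data.Nat.Divisibility using (_∣_; divides)
import Data.Nat.Properties as ℕ
open import Data.Product using (∃-syntax; _×_; _,_; proj₁; proj₂)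
import Data.Sign as Sign
open import Data.Sum using (_⊎_; inj₁; inj₂)
open import Data.Unit using (tt)
open import Data.Vec using (Vec; toList; []; _∷_)
open import Relation.Binary.Definitions using (tri<; tri≈; tri>)
open import Relation.Binary.PropositionalEquality as ≡ using (_≡_; _≢_)
open import Relation.Nullary using (yes; no; contradiction)

-- Algebra.Solver.Ring needs coefficients with decidable equality; ℤ maps into every commutative ring.
module IntegerCoefficients {c ℓ} (R : CommutativeRing c ℓ) where
  open CommutativeRing R
  open import Relation.Binary.Reasoning.Setoid setoid
  open import Algebra.Properties.Ring ring using (-‿distribˡ-*; -‿distribʳ-*)
  open import Algebra.Properties.Group +-group using (⁻¹-involutive; ε⁻¹≈ε)
  open import Algebra.Properties.AbelianGroup +-abelianGroup using (⁻¹-∙-comm)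
  open import Algebra.Properties.CommutativeSemigroup +-commutativeSemigroup using (interchange)
  open import Algebra.Properties.Semiring.Mult semiring using (×-homo-+; ×1-homo-*) renaming (_×_ to _×′_)
  open import Algebra.Solver.Ring.AlmostCommutativeRing
    using (fromCommutativeRing; _-Raw-AlmostCommutative⟶_)

  ⟦_⟧ : ℤ.ℤ → Carrier
  ⟦ ℤ.+ n ⟧      = n ×′ 1#
  ⟦ ℤ.-[1+ n ] ⟧ = - (suc n ×′ 1#)

  private
    x-y≈[a+x]-[a+y] : ∀ a x y → x - y ≈ (a + x) - (a + y)
    x-y≈[a+x]-[a+y] a x y = begin
      x - y                    ≈⟨ +-identityˡ _ ⟨
      0# + (x - y)             ≈⟨ +-congʳ (-‿inverseʳ a) ⟨
      (a - a) + (x - y)        ≈⟨ interchange a (- a) x (- y) ⟩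
      (a + x) + (- a + - y)    ≈⟨ +-congˡ (⁻¹-∙-comm a y) ⟩
      (a + x) - (a + y)        ∎

    ⊖-homo : ∀ m n → ⟦ m ℤ.⊖ n ⟧ ≈ m ×′ 1# - n ×′ 1#
    ⊖-homo m       zero    = sym (trans (+-congˡ ε⁻¹≈ε) (+-identityʳ _))
    ⊖-homo zero    (suc n) = sym (+-identityˡ _)
    ⊖-homo (suc m) (suc n) = begin
      ⟦ suc m ℤ.⊖ suc n ⟧        ≡⟨ ≡.cong ⟦_⟧ (ℤ.[1+m]⊖[1+n]≡m⊖n m n) ⟩
      ⟦ m ℤ.⊖ n ⟧                ≈⟨ ⊖-homo m n ⟩
      m ×′ 1# - n ×′ 1#          ≈⟨ x-y≈[a+x]-[a+y] 1# _ _ ⟩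
      suc m ×′ 1# - suc n ×′ 1#  ∎

    +-homo : ∀ i j → ⟦ i ℤ.+ j ⟧ ≈ ⟦ i ⟧ + ⟦ j ⟧
    +-homo (ℤ.+ m)    (ℤ.+ n)    = ×-homo-+ 1# m n
    +-homo (ℤ.+ m)    ℤ.-[1+ n ] = ⊖-homo m (suc n)
    +-homo ℤ.-[1+ m ] (ℤ.+ n)    = trans (⊖-homo n (suc m)) (+-comm _ _)
    +-homo ℤ.-[1+ m ] ℤ.-[1+ n ] = begin
      - (suc (suc (m ℕ.+ n)) ×′ 1#)      ≡⟨ ≡.cong (λ k → - (suc k ×′ 1#)) (ℕ.+-suc m n) ⟨
      - ((suc m ℕ.+ suc n) ×′ 1#)        ≈⟨ -‿cong (×-homo-+ 1# (suc m) (suc n)) ⟩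
      - (suc m ×′ 1# + suc n ×′ 1#)      ≈⟨ ⁻¹-∙-comm _ _ ⟨
      - (suc m ×′ 1#) + - (suc n ×′ 1#)  ∎

    ◃-homo : ∀ n → ⟦ Sign.- ℤ.◃ n ⟧ ≈ - (n ×′ 1#)
    ◃-homo zero    = sym ε⁻¹≈ε
    ◃-homo (suc n) = refl

    *-homo : ∀ i j → ⟦ i ℤ.* j ⟧ ≈ ⟦ i ⟧ * ⟦ j ⟧
    *-homo (ℤ.+ m)    (ℤ.+ n)    = trans (reflexive (≡.cong ⟦_⟧ (ℤ.+◃n≡+n (m ℕ.* n)))) (×1-homo-* m n)
    *-homo (ℤ.+ m)    ℤ.-[1+ n ] =
      trans (◃-homo (m ℕ.* suc n)) (trans (-‿cong (×1-homo-* m (suc n))) (-‿distribʳ-* _ _))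
    *-homo ℤ.-[1+ m ] (ℤ.+ n)    =
      trans (◃-homo (suc m ℕ.* n)) (trans (-‿cong (×1-homo-* (suc m) n)) (-‿distribˡ-* _ _))
    *-homo ℤ.-[1+ m ] ℤ.-[1+ n ] = begin
      (suc m ℕ.* suc n) ×′ 1#            ≈⟨ ×1-homo-* (suc m) (suc n) ⟩
      suc m ×′ 1# * suc n ×′ 1#          ≈⟨ ⁻¹-involutive _ ⟨
      - - (suc m ×′ 1# * suc n ×′ 1#)    ≈⟨ -‿cong (-‿distribˡ-* _ _) ⟩
      - (- (suc m ×′ 1#) * suc n ×′ 1#)  ≈⟨ -‿distribʳ-* _ _ ⟩
      - (suc m ×′ 1#) * - (suc n ×′ 1#)  ∎

    -‿homo : ∀ i → ⟦ ℤ.- i ⟧ ≈ - ⟦ i ⟧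
    -‿homo ℤ.-[1+ n ]   = sym (⁻¹-involutive _)
    -‿homo (ℤ.+ zero)   = sym ε⁻¹≈ε
    -‿homo (ℤ.+ suc n)  = refl

    ⟦⟧-homomorphism : ℤ.+-*-rawRing -Raw-AlmostCommutative⟶ fromCommutativeRing R
    ⟦⟧-homomorphism = record
      { ⟦_⟧    = ⟦_⟧
      ; +-homo = +-homo
      ; *-homo = *-homo
      ; -‿homo = -‿homo
      ; 0-homo = refl
      ; 1-homo = +-identityʳ 1#
      }

    ⟦⟧-≟ : ∀ i j → Maybe (⟦ i ⟧ ≈ ⟦ j ⟧)
    ⟦⟧-≟ i j with i ℤ.≟ j
    ... | yes ≡.refl = just refl
    ... | no _       = nothing

  open import Algebra.Solver.Ring ℤ.+-*-rawRing (fromCommutativeRing R) ⟦⟧-homomorphism ⟦⟧-≟ public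
    using (solve; _:=_; _:+_; _:*_; _:-_; :-_)

pattern 3+ n = suc (2+ n)
pattern 4+ n = suc (3+ n)
pattern 5+ n = suc (4+ n)

module Staircase {c ℓ} (R : CommutativeRing c ℓ) where
  open CommutativeRing R hiding (zero)
  open DRH R
  open IntegerCoefficients R
  open import Relation.Binary.Reasoning.Setoid setoid
  open import Algebra.Properties.Group +-group using (⁻¹-involutive; ε⁻¹≈ε)
  open import Algebra.Properties.Ring ring using (-‿distribˡ-*)

  -1^_ : ℕ → Carrier
  -1^ zero  = 1#
  -1^ suc m = - (-1^ m)

  alt-cong : ∀ m {x y} → x ≈ y → alt m x ≈ alt m y
  alt-cong zero    x≈y = x≈y
  alt-cong (suc m) x≈y = -‿cong (alt-cong m x≈y)

  alt-zero : ∀ m {x} → x ≈ 0# → alt m x ≈ 0#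
  alt-zero zero    x≈0 = x≈0
  alt-zero (suc m) x≈0 = trans (-‿cong (alt-zero m x≈0)) ε⁻¹≈ε

  alt≈-1^* : ∀ m x → alt m x ≈ -1^ m * x
  alt≈-1^* zero    x = sym (*-identityˡ x)
  alt≈-1^* (suc m) x = trans (-‿cong (alt≈-1^* m x)) (-‿distribˡ-* (-1^ m) x)

  -1^-square : ∀ m → -1^ m * -1^ m ≈ 1#
  -1^-square zero    = *-identityˡ 1#
  -1^-square (suc m) = trans (solve 1 (λ a → (:- a) :* (:- a) := a :* a) refl (-1^ m)) (-1^-square m)

  -- Grids are indexed by (height above the bottom row, column), like lookupCell; gridDet n reads rows
  -- n - 1, …, 0 from top to bottom.
  Grid : Set c
  Grid = ℕ → ℕ → Carrier

  gridDet : ℕ → Grid → Carrier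
  gridDet n G = det n (λ i j → G (n ∸ suc (toℕ i)) (toℕ j))

  punchInℕ : ℕ → ℕ → ℕ
  punchInℕ zero    x       = suc x
  punchInℕ (suc j) zero    = zero
  punchInℕ (suc j) (suc x) = suc (punchInℕ j x)

  removeColumn : ℕ → Grid → Grid
  removeColumn j G y x = G y (punchInℕ j x)

  toℕ-punchIn : ∀ {n} (j : Fin (suc n)) (k : Fin n) → toℕ (punchIn j k) ≡ punchInℕ (toℕ j) (toℕ k)
  toℕ-punchIn Fin.zero    k           = ≡.refl
  toℕ-punchIn (Fin.suc j) Fin.zero    = ≡.refl
  toℕ-punchIn (Fin.suc j) (Fin.suc k) = ≡.cong suc (toℕ-punchIn j k)

  punchInℕ-< : ∀ {j x} → x < j → punchInℕ j x ≡ x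
  punchInℕ-< {suc j} {zero}  _         = ≡.refl
  punchInℕ-< {suc j} {suc x} (s≤s x<j) = ≡.cong suc (punchInℕ-< x<j)

  punchInℕ-≥ : ∀ {j x} → j ≤ x → punchInℕ j x ≡ suc x
  punchInℕ-≥ {zero}  z≤n       = ≡.refl
  punchInℕ-≥ {suc j} (s≤s j≤x) = ≡.cong suc (punchInℕ-≥ j≤x)

  punchInℕ-punchInℕ : ∀ {a b} → a ≤ b → ∀ x → punchInℕ (suc b) (punchInℕ a x) ≡ punchInℕ a (punchInℕ b x)
  punchInℕ-punchInℕ z≤n       x       = ≡.refl
  punchInℕ-punchInℕ (s≤s a≤b) zero    = ≡.refl
  punchInℕ-punchInℕ (s≤s a≤b) (suc x) = ≡.cong suc (punchInℕ-punchInℕ a≤b x)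

  punchInℕ-preimage : ∀ {x col n} → x < suc n → col < suc n → x ≢ col →
    ∃[ col' ] col' < n × punchInℕ x col' ≡ col
  punchInℕ-preimage {x} {col} x<1+n col<1+n x≢col with ℕ.<-cmp x col
  ... | tri≈ _ x≡col _ = contradiction x≡col x≢col
  ... | tri> _ _ col<x = col , ℕ.<-≤-trans col<x (ℕ.≤-pred x<1+n) , punchInℕ-< col<x
  punchInℕ-preimage {col = suc col'} _ (s≤s col'<n) _ | tri< (s≤s x≤col') _ _ = col' , col'<n , punchInℕ-≥ x≤col'

  sumFin-cong : ∀ {n} {f g : Fin n → Carrier} → (∀ j → f j ≈ g j) → sumFin f ≈ sumFin g
  sumFin-cong {zero}  f≈g = refl
  sumFin-cong {suc n} f≈g = +-cong (f≈g Fin.zero) (sumFin-cong (λ j → f≈g (Fin.suc j)))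

  det-cong : ∀ n {A B : Matrix n} → (∀ i j → A i j ≈ B i j) → det n A ≈ det n B
  det-cong zero    A≈B = refl
  det-cong (suc n) A≈B = sumFin-cong λ j →
    alt-cong (toℕ j) (*-cong (A≈B Fin.zero j) (det-cong n (λ i k → A≈B (Fin.suc i) (punchIn j k))))

  gridDet-cong : ∀ n {G H : Grid} → (∀ y x → y < n → x < n → G y x ≈ H y x) → gridDet n G ≈ gridDet n H
  gridDet-cong zero     G≈H = refl
  gridDet-cong n@(suc m) G≈H = det-cong n (λ i j → G≈H _ _ (s≤s (ℕ.m∸n≤m m (toℕ i))) (Fin.toℕ<n j))

  ∑< : ℕ → (ℕ → Carrier) → Carrier
  ∑< zero  g = 0#
  ∑< (suc n) g = ∑< n g + g n

  ∑<-suc : ∀ n g → ∑< (suc n) g ≈ g 0 + ∑< n (λ x → g (suc x))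
  ∑<-suc zero    g = +-comm 0# (g 0)
  ∑<-suc (suc n) g = trans (+-congʳ (∑<-suc n g)) (+-assoc _ _ _)

  sumFin≈∑< : ∀ n (g : ℕ → Carrier) → sumFin {n} (λ j → g (toℕ j)) ≈ ∑< n g
  sumFin≈∑< zero    g = refl
  sumFin≈∑< (suc n) g = trans (+-congˡ (sumFin≈∑< n (λ x → g (suc x)))) (sym (∑<-suc n g))

  ∑<-zero : ∀ n g → (∀ x → x < n → g x ≈ 0#) → ∑< n g ≈ 0#
  ∑<-zero zero    g g≈0 = refl
  ∑<-zero (suc n) g g≈0 =
    trans (+-cong (∑<-zero n g (λ x x<n → g≈0 x (ℕ.m<n⇒m<1+n x<n))) (g≈0 n ℕ.≤-refl)) (+-identityʳ 0#)

  cofactorTerm : ℕ → Grid → ℕ → Carrier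
  cofactorTerm n G x = alt x (G n x * gridDet n (removeColumn x G))

  gridDet-expand : ∀ n G → gridDet (suc n) G ≈ ∑< (suc n) (cofactorTerm n G)
  gridDet-expand n G = trans
    (sumFin-cong λ j → alt-cong (toℕ j) (*-congˡ {G n (toℕ j)}
      (det-cong n λ i k → reflexive (≡.cong (G (n ∸ suc (toℕ i))) (toℕ-punchIn j k)))))
    (sumFin≈∑< (suc n) (cofactorTerm n G))

  cofactorTerms-vanish : ∀ n G p → (∀ x → x < p → G n x ≈ 0#) → ∑< p (cofactorTerm n G) ≈ 0#
  cofactorTerms-vanish n G p G≈0 = ∑<-zero p _ λ x x<p → alt-zero x (trans (*-congʳ (G≈0 x x<p)) (zeroˡ _))

  gridDet-lastTwoTerms : ∀ p G → (∀ x → x < p → G (suc p) x ≈ 0#) →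
    gridDet (2+ p) G ≈ cofactorTerm (suc p) G p + cofactorTerm (suc p) G (suc p)
  gridDet-lastTwoTerms p G G≈0 = trans (gridDet-expand (suc p) G)
    (+-congʳ (trans (+-congʳ (cofactorTerms-vanish (suc p) G p G≈0)) (+-identityˡ _)))

  gridDet-lastThreeTerms : ∀ p G → (∀ x → x < p → G (2+ p) x ≈ 0#) →
    gridDet (3+ p) G ≈ cofactorTerm (2+ p) G p + cofactorTerm (2+ p) G (suc p) + cofactorTerm (2+ p) G (2+ p)
  gridDet-lastThreeTerms p G G≈0 = trans (gridDet-expand (2+ p) G)
    (+-congʳ (+-congʳ (trans (+-congʳ (cofactorTerms-vanish (2+ p) G p G≈0)) (+-identityˡ _))))

  gridDet-zeroColumn : ∀ n G col → col < n → (∀ y → y < n → G y col ≈ 0#) → gridDet n G ≈ 0#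
  gridDet-zeroColumn (suc n) G col col<1+n G≈0 =
    trans (gridDet-expand n G) (∑<-zero (suc n) _ λ x x<1+n → alt-zero x (term≈0 x x<1+n))
    where
    term≈0 : ∀ x → x < suc n → G n x * gridDet n (removeColumn x G) ≈ 0#
    term≈0 x x<1+n with x ℕ.≟ col
    ... | yes ≡.refl = trans (*-congʳ (G≈0 n ℕ.≤-refl)) (zeroˡ _)
    ... | no x≢col   = let (col' , col'<n , punch≡col) = punchInℕ-preimage x<1+n col<1+n x≢col in
      trans (*-congˡ (gridDet-zeroColumn n (removeColumn x G) col' col'<n
        λ y y<n → trans (reflexive (≡.cong (G y) punch≡col)) (G≈0 y (ℕ.m<n⇒m<1+n y<n)))) (zeroʳ _)

  gridDet-1 : ∀ G → gridDet 1 G ≈ G 0 0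
  gridDet-1 G = trans (+-identityʳ _) (*-identityʳ _)

  minor₂ : Grid → ℕ → ℕ → ℕ → Carrier
  minor₂ G y x x' = G (suc y) x * G y x' - G (suc y) x' * G y x

  minor₂-≡ : ∀ G y x x' {a b c d} → G (suc y) x ≡ a → G y x' ≡ b → G (suc y) x' ≡ c → G y x ≡ d →
    minor₂ G y x x' ≡ a * b - c * d
  minor₂-≡ G y x x' ≡.refl ≡.refl ≡.refl ≡.refl = ≡.refl

  module TopTwoRows (p : ℕ) (G : Grid)
    (top≈0 : ∀ x → x < p → G (2+ p) x ≈ 0#)
    (second≈0 : ∀ x → x < p → G (suc p) x ≈ 0#)
    (last≈0 : ∀ y → y < suc p → G y (2+ p) ≈ 0#) where

    complement : ℕ → Carrier
    complement x = gridDet (suc p) (removeColumn x (removeColumn (2+ p) G))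

    minor-without-column : ∀ x → p ≤ x → x ≤ suc p →
      gridDet (2+ p) (removeColumn x G) ≈ alt (suc p) (G (suc p) (2+ p) * complement x)
    minor-without-column x p≤x x≤1+p = begin
      gridDet (2+ p) H
        ≈⟨ gridDet-lastTwoTerms p H (λ z z<p →
             trans (reflexive (≡.cong (G (suc p)) (punchInℕ-< (ℕ.<-≤-trans z<p p≤x)))) (second≈0 z z<p)) ⟩
      cofactorTerm (suc p) H p + cofactorTerm (suc p) H (suc p)
        ≈⟨ +-cong (alt-zero p (trans (*-congˡ (gridDet-zeroColumn (suc p) (removeColumn p H) p ℕ.≤-refl lastColumn≈0)) (zeroʳ _)))
                  (alt-cong (suc p) (*-cong (reflexive (≡.cong (G (suc p)) (punchInℕ-≥ x≤1+p)))
                     (gridDet-cong (suc p) λ y z _ _ → reflexive (≡.cong (G y) (≡.sym (punchInℕ-punchInℕ x≤1+p z)))))) ⟩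
      0# + alt (suc p) (G (suc p) (2+ p) * complement x)
        ≈⟨ +-identityˡ _ ⟩
      alt (suc p) (G (suc p) (2+ p) * complement x) ∎
      where
      H = removeColumn x G
      lastColumn≈0 : ∀ y → y < suc p → removeColumn p H y p ≈ 0#
      lastColumn≈0 y y<1+p = trans
        (reflexive (≡.cong (G y) (≡.trans (≡.cong (punchInℕ x) (punchInℕ-≥ ℕ.≤-refl)) (punchInℕ-≥ x≤1+p))))
        (last≈0 y y<1+p)

    minor-without-last : gridDet (2+ p) (removeColumn (2+ p) G) ≈
      alt p (G (suc p) p * complement p) + alt (suc p) (G (suc p) (suc p) * complement (suc p))
    minor-without-last = trans
      (gridDet-lastTwoTerms p (removeColumn (2+ p) G) λ z z<p →
        trans (reflexive (≡.cong (G (suc p)) (punchInℕ-< (ℕ.m<n⇒m<1+n (ℕ.m<n⇒m<1+n z<p))))) (second≈0 z z<p))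
      (+-cong (alt-cong p (*-congʳ (reflexive (≡.cong (G (suc p)) (punchInℕ-< (ℕ.m<n⇒m<1+n (ℕ.n<1+n p)))))))
              (alt-cong (suc p) (*-congʳ (reflexive (≡.cong (G (suc p)) (punchInℕ-< (ℕ.n<1+n (suc p))))))))

    gridDet-topTwoRows : gridDet (3+ p) G ≈ minor₂ G (suc p) (suc p) (2+ p) * complement (suc p) - minor₂ G (suc p) p (2+ p) * complement p
    gridDet-topTwoRows = begin
      gridDet (3+ p) G
        ≈⟨ gridDet-lastThreeTerms p G top≈0 ⟩
      cofactorTerm (2+ p) G p + cofactorTerm (2+ p) G (suc p) + cofactorTerm (2+ p) G (2+ p)
        ≈⟨ +-cong (+-cong (alt-cong p (*-congˡ (minor-without-column p ℕ.≤-refl (ℕ.n≤1+n p))))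
                          (alt-cong (suc p) (*-congˡ (minor-without-column (suc p) (ℕ.n≤1+n p) ℕ.≤-refl))))
                  (alt-cong (2+ p) (*-congˡ minor-without-last)) ⟩
      alt p (a * alt (suc p) (v * X₁)) + alt (suc p) (b * alt (suc p) (v * X₀))
        + alt (2+ p) (w * (alt p (c' * X₁) + alt (suc p) (d * X₀)))
        ≈⟨ +-cong (+-cong (trans (alt≈-1^* p _) (*-congˡ (*-congˡ (alt≈-1^* (suc p) _))))
                          (trans (alt≈-1^* (suc p) _) (*-congˡ (*-congˡ (alt≈-1^* (suc p) _)))))
                  (trans (alt≈-1^* (2+ p) _) (*-congˡ (*-congˡ (+-cong (alt≈-1^* p _) (alt≈-1^* (suc p) _))))) ⟩
      σ * (a * (- σ * (v * X₁))) + - σ * (b * (- σ * (v * X₀))) + - - σ * (w * (σ * (c' * X₁) + - σ * (d * X₀)))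
        ≈⟨ solve 9 (λ σ a b c' d v w X₀ X₁ →
              σ :* (a :* (:- σ :* (v :* X₁))) :+ :- σ :* (b :* (:- σ :* (v :* X₀)))
                :+ :- (:- σ) :* (w :* (σ :* (c' :* X₁) :+ :- σ :* (d :* X₀)))
              := (σ :* σ) :* ((b :* v :- w :* d) :* X₀ :- (a :* v :- w :* c') :* X₁))
            refl σ a b c' d v w X₀ X₁ ⟩
      σ * σ * ((b * v - w * d) * X₀ - (a * v - w * c') * X₁)
        ≈⟨ trans (*-congʳ (-1^-square p)) (*-identityˡ _) ⟩
      (b * v - w * d) * X₀ - (a * v - w * c') * X₁ ∎
      where
      σ = -1^ p
      a = G (2+ p) p
      b = G (2+ p) (suc p)
      w = G (2+ p) (2+ p)
      c' = G (suc p) p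
      d = G (suc p) (suc p)
      v = G (suc p) (2+ p)
      X₀ = complement (suc p)
      X₁ = complement p

  open TopTwoRows using (gridDet-topTwoRows)

  <ᵇ-true : ∀ {m n} → m < n → (m <ᵇ n) ≡ true
  <ᵇ-true {m} {n} m<n with m <ᵇ n | ℕ.<⇒<ᵇ m<n
  ... | true | _ = ≡.refl

  ≤ᵇ-true : ∀ {m n} → m ≤ n → (m ≤ᵇ n) ≡ true
  ≤ᵇ-true {m} {n} m≤n with m ≤ᵇ n | ℕ.≤⇒≤ᵇ m≤n
  ... | true | _ = ≡.refl

  <ᵇ-false : ∀ {m n} → n ≤ m → (m <ᵇ n) ≡ false
  <ᵇ-false {m} {n} n≤m with m <ᵇ n in eq
  ... | false = ≡.refl
  ... | true  = contradiction (ℕ.<ᵇ⇒< m n (≡.subst T (≡.sym eq) tt)) (ℕ.≤⇒≯ n≤m)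

  ≤ᵇ-false : ∀ {m n} → n < m → (m ≤ᵇ n) ≡ false
  ≤ᵇ-false (s≤s n≤m) = <ᵇ-false n≤m

  -- place moves on by x ℕ.+ wd p, which does not reduce to suc (suc x) when x is a variable.
  x+2≡2+x : ∀ x → x ℕ.+ 2 ≡ 2+ x
  x+2≡2+x x = ℕ.+-comm x 2

  +≤ : ∀ k {n m} → k ℕ.+ n ≤ m → n ℕ.+ k ≤ m
  +≤ k {n} {m} = ≡.subst (_≤ m) (ℕ.+-comm k n)

  offset-< : ∀ {a w} → a < w → ∀ x → a ℕ.+ x < x ℕ.+ w
  offset-< {a} {w} a<w x = ≡.subst (a ℕ.+ x <_) (ℕ.+-comm w x) (ℕ.+-monoˡ-< x a<w)

  <-offset : ∀ k {n y} → y < k ℕ.+ n → y < n ⊎ ∃[ b ] b < k × y ≡ b ℕ.+ n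
  <-offset k {n} {y} y<k+n with y ℕ.<? n
  ... | yes y<n = inj₁ y<n
  ... | no  y≮n = inj₂ (y ∸ n , y∸n<k , ≡.sym (ℕ.m∸n+n≡m n≤y))
    where
    n≤y = ℕ.≮⇒≥ y≮n
    y∸n<k = ≡.subst (y ∸ n <_) (ℕ.m+n∸n≡m k n) (ℕ.∸-monoˡ-< y<k+n n≤y)

  covers : Placed → ℕ → ℕ → Bool
  covers (x , y , p) cy cx = (x ≤ᵇ cx) ∧ (cx <ᵇ x ℕ.+ wd p) ∧ (y ≤ᵇ cy) ∧ (cy <ᵇ y ℕ.+ ht p)

  data Outside (cy cx : ℕ) : Placed → Set c where
    leftOf  : ∀ {x y p} → cx < x           → Outside cy cx (x , y , p)
    rightOf : ∀ {x y p} → x ℕ.+ wd p ≤ cx  → Outside cy cx (x , y , p)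
    below   : ∀ {x y p} → cy < y           → Outside cy cx (x , y , p)
    aboveOf : ∀ {x y p} → y ℕ.+ ht p ≤ cy  → Outside cy cx (x , y , p)

  outside⇒¬covers : ∀ {cy cx e} → Outside cy cx e → covers e cy cx ≡ false
  outside⇒¬covers (leftOf cx<x) rewrite ≤ᵇ-false cx<x = ≡.refl
  outside⇒¬covers {cy} {cx} (rightOf {x} {y} {p} le) rewrite <ᵇ-false le = ∧-zeroʳ (x ≤ᵇ cx)
  outside⇒¬covers {cy} {cx} (below {x} {y} {p} lt)
    rewrite ≤ᵇ-false lt | ∧-zeroʳ (cx <ᵇ x ℕ.+ wd p) = ∧-zeroʳ (x ≤ᵇ cx)
  outside⇒¬covers {cy} {cx} (aboveOf {x} {y} {p} le)
    rewrite <ᵇ-false le | ∧-zeroʳ (y ≤ᵇ cy) | ∧-zeroʳ (cx <ᵇ x ℕ.+ wd p) = ∧-zeroʳ (x ≤ᵇ cx)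

  lookupCell-outside : ∀ {cy cx e} rest → Outside cy cx e → lookupCell (e ∷ rest) cy cx ≡ lookupCell rest cy cx
  lookupCell-outside {e = x , y , p} rest o rewrite outside⇒¬covers o = ≡.refl

  lookupCell-allOutside : ∀ {cy cx} xs → All (Outside cy cx) xs → lookupCell xs cy cx ≡ 0#
  lookupCell-allOutside []       []       = ≡.refl
  lookupCell-allOutside (e ∷ xs) (o ∷ os) = ≡.trans (lookupCell-outside xs o) (lookupCell-allOutside xs os)

  lookupCell-++-outsideˡ : ∀ {cy cx} xs ys → All (Outside cy cx) xs → lookupCell (xs ++ ys) cy cx ≡ lookupCell ys cy cx
  lookupCell-++-outsideˡ []       ys []       = ≡.refl
  lookupCell-++-outsideˡ (e ∷ xs) ys (o ∷ os) = ≡.trans (lookupCell-outside (xs ++ ys) o) (lookupCell-++-outsideˡ xs ys os)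

  lookupCell-++-outsideʳ : ∀ {cy cx} xs ys → All (Outside cy cx) ys → lookupCell (xs ++ ys) cy cx ≡ lookupCell xs cy cx
  lookupCell-++-outsideʳ []               ys os = lookupCell-allOutside ys os
  lookupCell-++-outsideʳ {cy} {cx} ((x , y , p) ∷ xs) ys os with covers (x , y , p) cy cx
  ... | true  = ≡.refl
  ... | false = lookupCell-++-outsideʳ xs ys os

  lookupCell-hit : ∀ x y p rest {a b} → a < wd p → b < ht p →
    lookupCell ((x , y , p) ∷ rest) (b ℕ.+ y) (a ℕ.+ x) ≡ cell p (ht p ∸ suc b) a
  lookupCell-hit x y p rest {a} {b} a<wd b<ht
    rewrite ≤ᵇ-true (ℕ.m≤n+m x a) | <ᵇ-true (offset-< a<wd x) | ≤ᵇ-true (ℕ.m≤n+m y b) | <ᵇ-true (offset-< b<ht y)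
          | ℕ.m+n∸n≡m b y | ℕ.m+n∸n≡m a x = ≡.refl

  flatten : List (Block × Block) → List Block
  flatten []            = []
  flatten ((c , b) ∷ ps) = c ∷ b ∷ flatten ps

  advance : ℕ → List (Block × Block) → ℕ
  advance x []       = x
  advance x (_ ∷ ps) = advance (x ℕ.+ 2) ps

  advance-suc : ∀ x ps → advance (suc x) ps ≡ suc (advance x ps)
  advance-suc x []       = ≡.refl
  advance-suc x (_ ∷ ps) = advance-suc (x ℕ.+ 2) ps

  advance-≥ : ∀ x ps → x ≤ advance x ps
  advance-≥ x []       = ℕ.≤-refl
  advance-≥ x (_ ∷ ps) = ℕ.≤-trans (ℕ.m≤m+n x 2) (advance-≥ (x ℕ.+ 2) ps)

  place-flatten-++ : ∀ ps b x y t ts →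
    place right x y (bl b) (map bl (flatten ps) ++ t ∷ ts)
      ≡ place right x y (bl b) (map bl (flatten ps)) ++ place above (advance x ps ℕ.+ 2) (advance y ps) t ts
  place-flatten-++ []            b x y t ts = ≡.refl
  place-flatten-++ ((c , d) ∷ ps) b x y t ts =
    ≡.cong (λ l → (x , y , bl b) ∷ (x ℕ.+ 2 , y , bl c) ∷ l) (place-flatten-++ ps d (x ℕ.+ 2) (y ℕ.+ 2) t ts)

  rightEdge topEdge : Placed → ℕ
  rightEdge (x , y , p) = x ℕ.+ wd p
  topEdge   (x , y , p) = y ℕ.+ ht p

  Within : ℕ → ℕ → Placed → Set
  Within X Y e = rightEdge e ≤ X × topEdge e ≤ Y

  within-mono : ∀ {X Y X' Y' e} → X ≤ X' → Y ≤ Y' → Within X Y e → Within X' Y' e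
  within-mono X≤X' Y≤Y' (right≤X , top≤Y) = ℕ.≤-trans right≤X X≤X' , ℕ.≤-trans top≤Y Y≤Y'

  within⇒outside : ∀ {X Y cy cx} {e} → Within X Y e → X ≤ cx ⊎ Y ≤ cy → Outside cy cx e
  within⇒outside {e = x , y , p} (right≤X , _) (inj₁ X≤cx) = rightOf (ℕ.≤-trans right≤X X≤cx)
  within⇒outside {e = x , y , p} (_ , top≤Y) (inj₂ Y≤cy) = aboveOf (ℕ.≤-trans top≤Y Y≤cy)

  place-flatten-within : ∀ ps b x y →
    All (Within (advance x ps ℕ.+ 2) (advance y ps ℕ.+ 2)) (place right x y (bl b) (map bl (flatten ps)))
  place-flatten-within []            b x y = (ℕ.≤-refl , ℕ.≤-refl) ∷ []
  place-flatten-within ((c , d) ∷ ps) b x y =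
    (ℕ.+-monoˡ-≤ 2 (ℕ.≤-trans (ℕ.m≤m+n x 2) x+2≤) , ℕ.+-monoˡ-≤ 2 (ℕ.≤-trans (ℕ.m≤m+n y 2) y+2≤))
    ∷ (ℕ.+-monoˡ-≤ 2 x+2≤ , ℕ.+-monoˡ-≤ 2 (ℕ.≤-trans (ℕ.m≤m+n y 2) y+2≤))
    ∷ place-flatten-within ps d (x ℕ.+ 2) (y ℕ.+ 2)
    where
    x+2≤ = advance-≥ (x ℕ.+ 2) ps
    y+2≤ = advance-≥ (y ℕ.+ 2) ps

  stairs : HDom → Block → List (Block × Block) → List Placed
  stairs s b₁ ps = (0 , 0 , hd s) ∷ place right 0 1 (bl b₁) (map bl (flatten ps))

  stairs-within : ∀ s b₁ ps → All (Within (2+ (advance 0 ps)) (3+ (advance 0 ps))) (stairs s b₁ ps)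
  stairs-within s b₁ ps = (s≤s (s≤s z≤n) , s≤s z≤n) ∷
    All.map (λ {e} → within-mono {e = e} (ℕ.≤-reflexive (x+2≡2+x (advance 0 ps)))
                         (ℕ.≤-reflexive (≡.trans (x+2≡2+x (advance 1 ps)) (≡.cong (λ n → 2+ n) (advance-suc 0 ps)))))
            (place-flatten-within ps b₁ 0 1)

  staircase : HDom → Block → List (Block × Block) → List Piece → List Piece
  staircase s b₁ ps ending = hd s ∷ bl b₁ ∷ map bl (flatten ps) ++ ending

  placeAll-staircase : ∀ s b₁ ps t ts →
    placeAll (staircase s b₁ ps (t ∷ ts)) ≡ stairs s b₁ ps ++ place above (2+ (advance 0 ps)) (suc (advance 0 ps)) t ts
  placeAll-staircase s b₁ ps t ts rewrite place-flatten-++ ps b₁ 0 1 t ts | x+2≡2+x (advance 0 ps) | advance-suc 0 ps = ≡.refl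

  blocksColumnTail : ∀ q c b φ → place above (2+ q) (suc q) (bl c) (bl b ∷ vd φ ∷ [])
    ≡ (2+ q , suc q , bl c) ∷ (2+ q , 3+ q , bl b) ∷ (4+ q , 3+ q , vd φ) ∷ []
  blocksColumnTail q c b φ rewrite x+2≡2+x (suc q) = ≡.refl

  blockRowTail : ∀ q b f → place above (2+ q) (suc q) (bl b) (hd f ∷ [])
    ≡ (2+ q , suc q , bl b) ∷ (2+ q , 3+ q , hd f) ∷ []
  blockRowTail q b f rewrite x+2≡2+x (suc q) = ≡.refl

  flatten-∷ʳ : ∀ ps c b → flatten (ps ∷ʳ (c , b)) ≡ flatten ps ++ c ∷ b ∷ []
  flatten-∷ʳ []              c b = ≡.refl
  flatten-∷ʳ ((c' , b') ∷ ps) c b = ≡.cong (λ l → c' ∷ b' ∷ l) (flatten-∷ʳ ps c b)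

  staircase-∷ʳ : ∀ s b₁ ps c b ending → staircase s b₁ (ps ∷ʳ (c , b)) ending ≡ staircase s b₁ ps (bl c ∷ bl b ∷ ending)
  staircase-∷ʳ s b₁ ps c b ending = ≡.cong (λ l → hd s ∷ bl b₁ ∷ l)
    (≡.trans (≡.cong (λ l → map bl l ++ ending) (flatten-∷ʳ ps c b))
    (≡.trans (≡.cong (_++ ending) (List.map-++ bl (flatten ps) (c ∷ b ∷ [])))
             (List.++-assoc (map bl (flatten ps)) (bl c ∷ bl b ∷ []) ending)))

  map-flatten-∷ʳ : ∀ ps bk ending → map bl (flatten ps ∷ʳ bk) ++ ending ≡ map bl (flatten ps) ++ bl bk ∷ ending
  map-flatten-∷ʳ ps bk ending = ≡.trans (≡.cong (_++ ending) (List.map-++ bl (flatten ps) (bk ∷ [])))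
    (List.++-assoc (map bl (flatten ps)) (bl bk ∷ []) ending)

  maxEdge : (Placed → ℕ) → List Placed → ℕ
  maxEdge edge = foldr (λ e m → edge e ⊔ m) 0

  width≡maxEdge : ∀ L → width L ≡ maxEdge rightEdge (placeAll L)
  width≡maxEdge L = go (placeAll L)
    where
    go : ∀ xs → foldr (λ { (x , y , p) m → (x ℕ.+ wd p) ⊔ m }) 0 xs ≡ maxEdge rightEdge xs
    go []                = ≡.refl
    go ((x , y , p) ∷ xs) = ≡.cong ((x ℕ.+ wd p) ⊔_) (go xs)

  height≡maxEdge : ∀ L → height L ≡ maxEdge topEdge (placeAll L)
  height≡maxEdge L = go (placeAll L)
    where
    go : ∀ xs → foldr (λ { (x , y , p) m → (y ℕ.+ ht p) ⊔ m }) 0 xs ≡ maxEdge topEdge xs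
    go []                = ≡.refl
    go ((x , y , p) ∷ xs) = ≡.cong ((y ℕ.+ ht p) ⊔_) (go xs)

  maxEdge-≤ : ∀ edge {N} xs → All (λ e → edge e ≤ N) xs → maxEdge edge xs ≤ N
  maxEdge-≤ edge []       []           = z≤n
  maxEdge-≤ edge (e ∷ xs) (e≤N ∷ xs≤N) = ℕ.⊔-lub e≤N (maxEdge-≤ edge xs xs≤N)

  maxEdge-attained : ∀ edge {N} xs → All (λ e → edge e ≤ N) xs → Any (λ e → edge e ≡ N) xs → maxEdge edge xs ≡ N
  maxEdge-attained edge (e ∷ xs) (_ ∷ xs≤N) (here ≡.refl) = ℕ.m≥n⇒m⊔n≡m (maxEdge-≤ edge xs xs≤N)
  maxEdge-attained edge (e ∷ xs) (e≤N ∷ xs≤N) (there attained)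
    rewrite maxEdge-attained edge xs xs≤N attained = ℕ.m≤n⇒m⊔n≡n e≤N

  det-resized : ∀ w h N G → w ≡ N → h ≡ N → det w (λ i j → G (h ∸ suc (toℕ i)) (toℕ j)) ≡ gridDet N G
  det-resized w h N G ≡.refl ≡.refl = ≡.refl

  detDRH-square : ∀ L N xs → placeAll L ≡ xs → All (Within N N) xs →
    Any (λ e → rightEdge e ≡ N) xs → Any (λ e → topEdge e ≡ N) xs → detDRH L ≡ gridDet N (lookupCell xs)
  detDRH-square L N _ ≡.refl within right≡N top≡N = det-resized (width L) (height L) N (lookupCell (placeAll L))
    (≡.trans (width≡maxEdge L) (maxEdge-attained rightEdge _ (All.map (λ {e} → proj₁ {B = λ _ → topEdge e ≤ N}) within) right≡N))
    (≡.trans (height≡maxEdge L) (maxEdge-attained topEdge _ (All.map (λ {e} → proj₂ {A = rightEdge e ≤ N}) within) top≡N))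

  Vec2 : Set c
  Vec2 = Carrier × Carrier

  _·_ : Vec2 → Vec2 → Carrier
  (x₁ , x₂) · (y₁ , y₂) = x₁ * y₁ + x₂ * y₂

  wedge : Vec2 → Vec2 → Carrier
  wedge (x₁ , x₂) (y₁ , y₂) = x₁ * y₂ - x₂ * y₁

  _⋆_ : Vec2 → Block → Vec2
  (x₁ , x₂) ⋆ ((a , b) , (c , d)) = (x₁ * a + x₂ * c , x₁ * b + x₂ * d)

  turn : Vec2 → Block → Vec2
  turn x b = (- wedge x (h₋ b) , wedge x (h₊ b))

  ≈ₕ-sym : ∀ {x y} → x ≈ₕ y → y ≈ₕ x
  ≈ₕ-sym (x₁≈y₁ , x₂≈y₂) = sym x₁≈y₁ , sym x₂≈y₂

  wedge-cong : ∀ {x x' y y'} → x ≈ₕ x' → y ≈ₕ y' → wedge x y ≈ wedge x' y'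
  wedge-cong (x₁≈ , x₂≈) (y₁≈ , y₂≈) = +-cong (*-cong x₁≈ y₂≈) (-‿cong (*-cong x₂≈ y₁≈))

  turn-cong : ∀ {x y} b → x ≈ₕ y → turn x b ≈ₕ turn y b
  turn-cong b x≈y = -‿cong (wedge-cong x≈y (refl , refl)) , wedge-cong x≈y (refl , refl)

  ·-congʳ : ∀ {x y} z → x ≈ₕ y → x · z ≈ y · z
  ·-congʳ z (x₁≈ , x₂≈) = +-cong (*-congʳ x₁≈) (*-congʳ x₂≈)

  column : ℕ → Block → VDom
  column zero    ((a , b) , (c , d)) = (a , c)
  column (suc _) ((a , b) , (c , d)) = (b , d)

  cell-column : ∀ j r blk → cell (bl blk) r j ≡ cell (vd (column j blk)) r 0
  cell-column zero    zero    ((a , b) , (c , d)) = ≡.refl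
  cell-column zero    (suc _) ((a , b) , (c , d)) = ≡.refl
  cell-column (suc _) zero    ((a , b) , (c , d)) = ≡.refl
  cell-column (suc _) (suc _) ((a , b) , (c , d)) = ≡.refl

  ·-column : ∀ x blk → (x · column 0 blk , x · column 1 blk) ≡ x ⋆ blk
  ·-column (x₁ , x₂) ((a , b) , (c , d)) = ≡.refl

  transfer : Block → Block → Vec2 → Vec2
  transfer c b u = turn (u ⋆ c) b

  transferAll : Vec2 → List (Block × Block) → Vec2
  transferAll u []            = u
  transferAll u ((c , b) ∷ ps) = transferAll (transfer c b u) ps

  transferAll-∷ʳ : ∀ u ps c b → transferAll u (ps ∷ʳ (c , b)) ≡ transfer c b (transferAll u ps)
  transferAll-∷ʳ u []              c b = ≡.refl
  transferAll-∷ʳ u ((c' , b') ∷ ps) c b = transferAll-∷ʳ (transfer c' b' u) ps c b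

  staircaseVector : HDom → Block → List (Block × Block) → Vec2
  staircaseVector s b₁ = transferAll (turn s b₁)

  module Extension (q : ℕ) (base : List Placed) (base-within : All (Within (2+ q) (3+ q)) base) where

    withColumn : VDom → Carrier
    withColumn φ = gridDet (3+ q) (lookupCell (base ++ (2+ q , suc q , vd φ) ∷ []))

    base-outsideʳ : ∀ {y x} → 2+ q ≤ x → All (Outside y x) base
    base-outsideʳ 2+q≤x = All.map (λ {e} w → within⇒outside {e = e} w (inj₁ 2+q≤x)) base-within

    base-outsideᵗ : ∀ {y x} → 3+ q ≤ y → All (Outside y x) base
    base-outsideᵗ 3+q≤y = All.map (λ {e} w → within⇒outside {e = e} w (inj₂ 3+q≤y)) base-within

    gridDet≈withColumn : ∀ G φ →
      (∀ y x → y < 3+ q → x < 2+ q → G y x ≡ lookupCell base y x) →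
      (∀ y → y < 3+ q → G y (2+ q) ≡ lookupCell ((2+ q , suc q , vd φ) ∷ []) y (2+ q)) →
      gridDet (3+ q) G ≈ withColumn φ
    gridDet≈withColumn G φ G-left G-last = gridDet-cong (3+ q) λ y x y<3+q x<3+q → reflexive (entry y x y<3+q x<3+q)
      where
      entry : ∀ y x → y < 3+ q → x < 3+ q → G y x ≡ lookupCell (base ++ (2+ q , suc q , vd φ) ∷ []) y x
      entry y x y<3+q x<3+q with <-offset 1 x<3+q
      ... | inj₁ x<2+q            = ≡.trans (G-left y x y<3+q x<2+q) (≡.sym (lookupCell-++-outsideʳ base _ (leftOf x<2+q ∷ [])))
      ... | inj₂ (zero , _ , ≡.refl) = ≡.trans (G-last y y<3+q) (≡.sym (lookupCell-++-outsideˡ base _ (base-outsideʳ ℕ.≤-refl)))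
      ... | inj₂ (suc _ , s≤s () , _)

    module OnTopOfBlock (blk : Block) (rest : List Placed)
      (rest-left : ∀ {y x} → x < 2+ q → All (Outside y x) rest)
      (rest-above : ∀ {y x} → y < 3+ q → All (Outside y x) rest) where

      G : Grid
      G = lookupCell (base ++ (2+ q , suc q , bl blk) ∷ rest)

      G-top : ∀ y x → 3+ q ≤ y → G y x ≡ lookupCell rest y x
      G-top y x 3+q≤y = ≡.trans (lookupCell-++-outsideˡ base _ (base-outsideᵗ 3+q≤y))
        (lookupCell-outside {e = 2+ q , suc q , bl blk} rest (aboveOf (≡.subst (_≤ y) (≡.sym (x+2≡2+x (suc q))) 3+q≤y)))

      G-left : ∀ y x → x < 2+ q → G y x ≡ lookupCell base y x
      G-left y x x<2+q = lookupCell-++-outsideʳ base _ (leftOf x<2+q ∷ rest-left x<2+q)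

      blockColumn : ∀ a y → a < 2 → y < 3+ q →
        lookupCell ((2+ q , suc q , bl blk) ∷ rest) y (a ℕ.+ 2+ q) ≡ lookupCell ((2+ q , suc q , vd (column a blk)) ∷ []) y (2+ q)
      blockColumn a y a<2 y<3+q with <-offset 2 y<3+q
      ... | inj₁ y<1+q = ≡.trans (lookupCell-outside {cx = a ℕ.+ 2+ q} {e = 2+ q , suc q , bl blk} rest (below y<1+q))
        (≡.trans (lookupCell-allOutside rest (rest-above y<3+q))
          (≡.sym (lookupCell-outside {cx = 2+ q} {e = 2+ q , suc q , vd (column a blk)} [] (below y<1+q))))
      ... | inj₂ (b , b<2 , ≡.refl) = ≡.trans (lookupCell-hit (2+ q) (suc q) (bl blk) rest a<2 b<2)
        (≡.trans (cell-column a (2 ∸ suc b) blk) (≡.sym (lookupCell-hit (2+ q) (suc q) (vd (column a blk)) [] (s≤s z≤n) b<2)))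

      G-blockColumn : ∀ a y → a < 2 → y < 3+ q →
        G y (a ℕ.+ 2+ q) ≡ lookupCell ((2+ q , suc q , vd (column a blk)) ∷ []) y (2+ q)
      G-blockColumn a y a<2 y<3+q = ≡.trans (lookupCell-++-outsideˡ base _ (base-outsideʳ (ℕ.m≤n+m _ a))) (blockColumn a y a<2 y<3+q)

      gridDet-selectColumn : ∀ a (σ : ℕ → ℕ) → a < 2 → (∀ x → x < 2+ q → σ x ≡ x) → σ (2+ q) ≡ a ℕ.+ 2+ q →
        gridDet (3+ q) (λ y x → G y (σ x)) ≈ withColumn (column a blk)
      gridDet-selectColumn a σ a<2 σ-left σ-last = gridDet≈withColumn H (column a blk) H-left H-last
        where
        H : Grid
        H y x = G y (σ x)
        H-left : ∀ y x → y < 3+ q → x < 2+ q → H y x ≡ lookupCell base y x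
        H-left y x _ x<2+q = ≡.trans (≡.cong (G y) (σ-left x x<2+q)) (G-left y x x<2+q)
        H-last : ∀ y → y < 3+ q → H y (2+ q) ≡ lookupCell ((2+ q , suc q , vd (column a blk)) ∷ []) y (2+ q)
        H-last y y<3+q = ≡.trans (≡.cong (G y) σ-last) (G-blockColumn a y a<2 y<3+q)

    gridDet-blocksColumn : ∀ c b φ →
      gridDet (5+ q) (lookupCell (base ++ (2+ q , suc q , bl c) ∷ (2+ q , 3+ q , bl b) ∷ (4+ q , 3+ q , vd φ) ∷ []))
        ≈ turn (withColumn (column 0 c) , withColumn (column 1 c)) b · φ
    gridDet-blocksColumn c b@((b₁₁ , b₁₂) , (b₂₁ , b₂₂)) φ@(φ₁ , φ₂) = begin
      gridDet (5+ q) G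
        ≈⟨ gridDet-topTwoRows (2+ q) G top≈0 second≈0 last≈0 ⟩
      minor₂ G (3+ q) (3+ q) (4+ q) * gridDet (3+ q) (removeColumn (3+ q) (removeColumn (4+ q) G))
        - minor₂ G (3+ q) (2+ q) (4+ q) * gridDet (3+ q) (removeColumn (2+ q) (removeColumn (4+ q) G))
        ≈⟨ +-cong (*-cong (reflexive (minor₂-≡ G (3+ q) (3+ q) (4+ q) b₁₂-entry φ₂-entry φ₁-entry b₂₂-entry)) X₀-complement)
                  (-‿cong (*-cong (reflexive (minor₂-≡ G (3+ q) (2+ q) (4+ q) b₁₁-entry φ₂-entry φ₁-entry b₂₁-entry))
                                  X₁-complement)) ⟩
      (b₁₂ * φ₂ - φ₁ * b₂₂) * X₀ - (b₁₁ * φ₂ - φ₁ * b₂₁) * X₁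
        ≈⟨ solve 8 (λ b₁₁ b₁₂ b₂₁ b₂₂ φ₁ φ₂ X₀ X₁ →
              (b₁₂ :* φ₂ :- φ₁ :* b₂₂) :* X₀ :- (b₁₁ :* φ₂ :- φ₁ :* b₂₁) :* X₁
              := (:- (X₀ :* b₂₂ :- X₁ :* b₂₁)) :* φ₁ :+ (X₀ :* b₁₂ :- X₁ :* b₁₁) :* φ₂)
            refl b₁₁ b₁₂ b₂₁ b₂₂ φ₁ φ₂ X₀ X₁ ⟩
      turn (X₀ , X₁) b · φ ∎
      where
      X₀ = withColumn (column 0 c)
      X₁ = withColumn (column 1 c)
      rest = (2+ q , 3+ q , bl b) ∷ (4+ q , 3+ q , vd φ) ∷ []
      rest-left : ∀ {y x} → x < 2+ q → All (Outside y x) rest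
      rest-left x<2+q = leftOf x<2+q ∷ leftOf (ℕ.m<n⇒m<1+n (ℕ.m<n⇒m<1+n x<2+q)) ∷ []
      open OnTopOfBlock c rest rest-left (λ y<3+q → below y<3+q ∷ below y<3+q ∷ [])
      2+q+2≤4+q : 2+ q ℕ.+ 2 ≤ 4+ q
      2+q+2≤4+q = ℕ.≤-reflexive (x+2≡2+x (2+ q))
      bEntry : ∀ {a b'} → a < 2 → b' < 2 → G (b' ℕ.+ 3+ q) (a ℕ.+ 2+ q) ≡ cell (bl b) (2 ∸ suc b') a
      bEntry {a} {b'} a<2 b'<2 = ≡.trans (G-top (b' ℕ.+ 3+ q) (a ℕ.+ 2+ q) (ℕ.m≤n+m _ b'))
        (lookupCell-hit (2+ q) (3+ q) (bl b) ((4+ q , 3+ q , vd φ) ∷ []) a<2 b'<2)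
      φEntry : ∀ {b'} → b' < 2 → G (b' ℕ.+ 3+ q) (4+ q) ≡ cell (vd φ) (2 ∸ suc b') 0
      φEntry {b'} b'<2 = ≡.trans (G-top (b' ℕ.+ 3+ q) (4+ q) (ℕ.m≤n+m _ b'))
        (≡.trans (lookupCell-outside {cy = b' ℕ.+ 3+ q} {cx = 4+ q} {e = 2+ q , 3+ q , bl b} ((4+ q , 3+ q , vd φ) ∷ [])
                                      (rightOf 2+q+2≤4+q))
                 (lookupCell-hit (4+ q) (3+ q) (vd φ) [] (s≤s z≤n) b'<2))
      b₁₁-entry = bEntry {0} {1} (s≤s z≤n) (s≤s (s≤s z≤n))
      b₁₂-entry = bEntry {1} {1} (s≤s (s≤s z≤n)) (s≤s (s≤s z≤n))
      b₂₁-entry = bEntry {0} {0} (s≤s z≤n) (s≤s z≤n)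
      b₂₂-entry = bEntry {1} {0} (s≤s (s≤s z≤n)) (s≤s z≤n)
      φ₁-entry = φEntry {1} (s≤s (s≤s z≤n))
      φ₂-entry = φEntry {0} (s≤s z≤n)
      top≈0 : ∀ x → x < 2+ q → G (4+ q) x ≈ 0#
      top≈0 x x<2+q = reflexive (≡.trans (G-top (4+ q) x (ℕ.n≤1+n _)) (lookupCell-allOutside {4+ q} {x} rest (rest-left x<2+q)))
      second≈0 : ∀ x → x < 2+ q → G (3+ q) x ≈ 0#
      second≈0 x x<2+q = reflexive (≡.trans (G-top (3+ q) x ℕ.≤-refl) (lookupCell-allOutside {3+ q} {x} rest (rest-left x<2+q)))
      last≈0 : ∀ y → y < 3+ q → G y (4+ q) ≈ 0#
      last≈0 y y<3+q = reflexive (≡.trans (lookupCell-++-outsideˡ base _ (base-outsideʳ (ℕ.m≤n+m _ 2)))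
        (lookupCell-allOutside {y} {4+ q} ((2+ q , suc q , bl c) ∷ rest) (rightOf 2+q+2≤4+q ∷ rightOf 2+q+2≤4+q ∷ below y<3+q ∷ [])))
      X₀-complement : gridDet (3+ q) (removeColumn (3+ q) (removeColumn (4+ q) G)) ≈ X₀
      X₀-complement = gridDet-selectColumn 0 (λ x → punchInℕ (4+ q) (punchInℕ (3+ q) x)) (s≤s z≤n)
        (λ x x<2+q → ≡.trans (≡.cong (punchInℕ (4+ q)) (punchInℕ-< (ℕ.m<n⇒m<1+n x<2+q)))
                             (punchInℕ-< (ℕ.m<n⇒m<1+n (ℕ.m<n⇒m<1+n x<2+q))))
        (≡.trans (≡.cong (punchInℕ (4+ q)) (punchInℕ-< (ℕ.n<1+n (2+ q)))) (punchInℕ-< (ℕ.m<n⇒m<1+n (ℕ.n<1+n (2+ q)))))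
      X₁-complement : gridDet (3+ q) (removeColumn (2+ q) (removeColumn (4+ q) G)) ≈ X₁
      X₁-complement = gridDet-selectColumn 1 (λ x → punchInℕ (4+ q) (punchInℕ (2+ q) x)) (s≤s (s≤s z≤n))
        (λ x x<2+q → ≡.trans (≡.cong (punchInℕ (4+ q)) (punchInℕ-< x<2+q)) (punchInℕ-< (ℕ.m<n⇒m<1+n (ℕ.m<n⇒m<1+n x<2+q))))
        (≡.trans (≡.cong (punchInℕ (4+ q)) (punchInℕ-≥ (ℕ.≤-refl {2+ q}))) (punchInℕ-< (ℕ.n<1+n (3+ q))))

    gridDet-blockRow : ∀ b f →
      gridDet (4+ q) (lookupCell (base ++ (2+ q , suc q , bl b) ∷ (2+ q , 3+ q , hd f) ∷ []))
        ≈ alt (2+ q) (proj₁ f * withColumn (column 1 b)) + alt (3+ q) (proj₂ f * withColumn (column 0 b))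
    gridDet-blockRow b f@(f₁ , f₂) = trans (gridDet-lastTwoTerms (2+ q) G top≈0)
      (+-cong (alt-cong (2+ q) (*-cong (reflexive (fEntry {0} (s≤s z≤n))) X₁-complement))
              (alt-cong (3+ q) (*-cong (reflexive (fEntry {1} (s≤s (s≤s z≤n)))) X₀-complement)))
      where
      open OnTopOfBlock b ((2+ q , 3+ q , hd f) ∷ []) (λ x<2+q → leftOf x<2+q ∷ []) (λ y<3+q → below y<3+q ∷ [])
      fEntry : ∀ {a} → a < 2 → G (3+ q) (a ℕ.+ 2+ q) ≡ cell (hd f) 0 a
      fEntry {a} a<2 = ≡.trans (G-top (3+ q) (a ℕ.+ 2+ q) ℕ.≤-refl) (lookupCell-hit (2+ q) (3+ q) (hd f) [] {b = 0} a<2 (s≤s z≤n))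
      top≈0 : ∀ x → x < 2+ q → G (3+ q) x ≈ 0#
      top≈0 x x<2+q = reflexive (≡.trans (G-top (3+ q) x ℕ.≤-refl)
        (lookupCell-allOutside {3+ q} {x} ((2+ q , 3+ q , hd f) ∷ []) (leftOf x<2+q ∷ [])))
      X₀-complement : gridDet (3+ q) (removeColumn (3+ q) G) ≈ withColumn (column 0 b)
      X₀-complement = gridDet-selectColumn 0 (punchInℕ (3+ q)) (s≤s z≤n)
        (λ x x<2+q → punchInℕ-< (ℕ.m<n⇒m<1+n x<2+q)) (punchInℕ-< (ℕ.n<1+n (2+ q)))
      X₁-complement : gridDet (3+ q) (removeColumn (2+ q) G) ≈ withColumn (column 1 b)
      X₁-complement = gridDet-selectColumn 1 (punchInℕ (2+ q)) (s≤s (s≤s z≤n))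
        (λ x x<2+q → punchInℕ-< x<2+q) (punchInℕ-≥ (ℕ.≤-refl {2+ q}))

  module StaircaseGrids (s : HDom) (b₁ : Block) (ps : List (Block × Block)) where

    q : ℕ
    q = advance 0 ps

    open Extension q (stairs s b₁ ps) (stairs-within s b₁ ps) public

    stairs-within′ : ∀ {X Y} → 2+ q ≤ X → 3+ q ≤ Y → All (Within X Y) (stairs s b₁ ps)
    stairs-within′ 2+q≤X 3+q≤Y = All.map (λ {e} → within-mono {e = e} 2+q≤X 3+q≤Y) (stairs-within s b₁ ps)

    detDRH-column : ∀ φ → detDRH (staircase s b₁ ps (vd φ ∷ [])) ≡ withColumn φ
    detDRH-column φ = detDRH-square (staircase s b₁ ps (vd φ ∷ [])) (3+ q) _ (placeAll-staircase s b₁ ps (vd φ) [])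
      (++⁺ (stairs-within′ (ℕ.n≤1+n _) ℕ.≤-refl) ((+≤ 1 ℕ.≤-refl , +≤ 2 ℕ.≤-refl) ∷ []))
      (++⁺ʳ (stairs s b₁ ps) (here (ℕ.+-comm (2+ q) 1)))
      (++⁺ʳ (stairs s b₁ ps) (here (ℕ.+-comm (suc q) 2)))

    detDRH-blocksColumn : ∀ c b φ → detDRH (staircase s b₁ ps (bl c ∷ bl b ∷ vd φ ∷ [])) ≡
      gridDet (5+ q) (lookupCell (stairs s b₁ ps ++ (2+ q , suc q , bl c) ∷ (2+ q , 3+ q , bl b) ∷ (4+ q , 3+ q , vd φ) ∷ []))
    detDRH-blocksColumn c b φ = detDRH-square (staircase s b₁ ps (bl c ∷ bl b ∷ vd φ ∷ [])) (5+ q) _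
      (≡.trans (placeAll-staircase s b₁ ps (bl c) (bl b ∷ vd φ ∷ [])) (≡.cong (stairs s b₁ ps ++_) (blocksColumnTail q c b φ)))
      (++⁺ (stairs-within′ (ℕ.m≤n+m _ 3) (ℕ.m≤n+m _ 2))
        ((+≤ 2 (ℕ.n≤1+n _) , +≤ 2 (ℕ.m≤n+m _ 2))
         ∷ (+≤ 2 (ℕ.n≤1+n _) , +≤ 2 ℕ.≤-refl)
         ∷ (+≤ 1 ℕ.≤-refl , +≤ 2 ℕ.≤-refl) ∷ []))
      (++⁺ʳ (stairs s b₁ ps) (there (there (here (ℕ.+-comm (4+ q) 1)))))
      (++⁺ʳ (stairs s b₁ ps) (there (here (ℕ.+-comm (3+ q) 2))))

    detDRH-blockRow : ∀ b f → detDRH (staircase s b₁ ps (bl b ∷ hd f ∷ [])) ≡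
      gridDet (4+ q) (lookupCell (stairs s b₁ ps ++ (2+ q , suc q , bl b) ∷ (2+ q , 3+ q , hd f) ∷ []))
    detDRH-blockRow b f = detDRH-square (staircase s b₁ ps (bl b ∷ hd f ∷ [])) (4+ q) _
      (≡.trans (placeAll-staircase s b₁ ps (bl b) (hd f ∷ [])) (≡.cong (stairs s b₁ ps ++_) (blockRowTail q b f)))
      (++⁺ (stairs-within′ (ℕ.m≤n+m _ 2) (ℕ.n≤1+n _))
        ((+≤ 2 ℕ.≤-refl , +≤ 2 (ℕ.n≤1+n _)) ∷ (+≤ 2 ℕ.≤-refl , +≤ 1 ℕ.≤-refl) ∷ []))
      (++⁺ʳ (stairs s b₁ ps) (here (ℕ.+-comm (2+ q) 2)))
      (++⁺ʳ (stairs s b₁ ps) (there (here (ℕ.+-comm (3+ q) 1))))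

  withColumn-initial : ∀ s b₁ φ → StaircaseGrids.withColumn s b₁ [] φ ≈ turn s b₁ · φ
  withColumn-initial s@(s₁ , s₂) b₁@((b₁₁ , b₁₂) , (b₂₁ , b₂₂)) φ@(φ₁ , φ₂) = begin
    gridDet 3 G
      ≈⟨ gridDet-topTwoRows 0 G (λ _ ()) (λ _ ()) (λ { zero _ → refl ; (suc _) (s≤s ()) }) ⟩
    minor₂ G 1 1 2 * gridDet 1 (removeColumn 1 (removeColumn 2 G)) - minor₂ G 1 0 2 * gridDet 1 (removeColumn 0 (removeColumn 2 G))
      ≈⟨ +-cong (*-congˡ (gridDet-1 (removeColumn 1 (removeColumn 2 G))))
                (-‿cong (*-congˡ (gridDet-1 (removeColumn 0 (removeColumn 2 G))))) ⟩
    (b₁₂ * φ₂ - φ₁ * b₂₂) * s₁ - (b₁₁ * φ₂ - φ₁ * b₂₁) * s₂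
      ≈⟨ solve 8 (λ s₁ s₂ b₁₁ b₁₂ b₂₁ b₂₂ φ₁ φ₂ →
            (b₁₂ :* φ₂ :- φ₁ :* b₂₂) :* s₁ :- (b₁₁ :* φ₂ :- φ₁ :* b₂₁) :* s₂
            := (:- (s₁ :* b₂₂ :- s₂ :* b₂₁)) :* φ₁ :+ (s₁ :* b₁₂ :- s₂ :* b₁₁) :* φ₂)
          refl s₁ s₂ b₁₁ b₁₂ b₂₁ b₂₂ φ₁ φ₂ ⟩
    turn s b₁ · φ ∎
    where
    G = lookupCell (stairs s b₁ [] ++ (2 , 1 , vd φ) ∷ [])

  detDRH-staircaseColumn : ∀ s b₁ ps φ → detDRH (staircase s b₁ ps (vd φ ∷ [])) ≈ staircaseVector s b₁ ps · φ
  detDRH-staircaseColumn s b₁ ps = go ps (reverseView ps)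
    where
    go : ∀ ps → Reverse ps → ∀ φ → detDRH (staircase s b₁ ps (vd φ ∷ [])) ≈ staircaseVector s b₁ ps · φ
    go _ [] φ = withColumn-initial s b₁ φ
    go _ (ps ∶ rs ∶ʳ (c , b)) φ = begin
      detDRH (staircase s b₁ (ps ∷ʳ (c , b)) (vd φ ∷ []))
        ≡⟨ ≡.cong detDRH (staircase-∷ʳ s b₁ ps c b (vd φ ∷ [])) ⟩
      detDRH (staircase s b₁ ps (bl c ∷ bl b ∷ vd φ ∷ []))
        ≡⟨ detDRH-blocksColumn c b φ ⟩
      gridDet (5+ q) (lookupCell (stairs s b₁ ps ++ (2+ q , suc q , bl c) ∷ (2+ q , 3+ q , bl b) ∷ (4+ q , 3+ q , vd φ) ∷ []))
        ≈⟨ gridDet-blocksColumn c b φ ⟩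
      turn (withColumn (column 0 c) , withColumn (column 1 c)) b · φ
        ≈⟨ ·-congʳ φ (turn-cong b (withColumn≈ (column 0 c) , withColumn≈ (column 1 c))) ⟩
      turn (u · column 0 c , u · column 1 c) b · φ
        ≡⟨ ≡.cong (λ v → turn v b · φ) (·-column u c) ⟩
      transfer c b u · φ
        ≡⟨ ≡.cong (_· φ) (transferAll-∷ʳ (turn s b₁) ps c b) ⟨
      staircaseVector s b₁ (ps ∷ʳ (c , b)) · φ ∎
      where
      open StaircaseGrids s b₁ ps
      u = staircaseVector s b₁ ps
      withColumn≈ : ∀ v → withColumn v ≈ u · v
      withColumn≈ v = trans (reflexive (≡.sym (detDRH-column v))) (go ps rs v)

  alt-advance : ∀ x ps z → alt (advance x ps) z ≈ alt x z
  alt-advance x []       z = refl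
  alt-advance x (_ ∷ ps) z = trans (alt-advance (x ℕ.+ 2) ps z) alt-x+2
    where
    alt-x+2 : alt (x ℕ.+ 2) z ≈ alt x z
    alt-x+2 rewrite x+2≡2+x x = ⁻¹-involutive (alt x z)

  detDRH-staircaseRow : ∀ s b₁ ps b f → detDRH (staircase s b₁ ps (bl b ∷ hd f ∷ [])) ≈ wedge f (staircaseVector s b₁ ps ⋆ b)
  detDRH-staircaseRow s b₁ ps b f@(f₁ , f₂) = begin
    detDRH (staircase s b₁ ps (bl b ∷ hd f ∷ []))
      ≡⟨ detDRH-blockRow b f ⟩
    gridDet (4+ q) (lookupCell (stairs s b₁ ps ++ (2+ q , suc q , bl b) ∷ (2+ q , 3+ q , hd f) ∷ []))
      ≈⟨ gridDet-blockRow b f ⟩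
    alt (2+ q) (f₁ * withColumn (column 1 b)) + alt (3+ q) (f₂ * withColumn (column 0 b))
      ≈⟨ +-cong alt-even (-‿cong alt-even) ⟩
    f₁ * withColumn (column 1 b) - f₂ * withColumn (column 0 b)
      ≈⟨ +-cong (*-congˡ (withColumn≈ (column 1 b))) (-‿cong (*-congˡ (withColumn≈ (column 0 b)))) ⟩
    f₁ * (u · column 1 b) - f₂ * (u · column 0 b)
      ≡⟨ ≡.cong (wedge f) (·-column u b) ⟩
    wedge f (u ⋆ b) ∎
    where
    open StaircaseGrids s b₁ ps
    u = staircaseVector s b₁ ps
    withColumn≈ : ∀ v → withColumn v ≈ u · v
    withColumn≈ v = trans (reflexive (≡.sym (detDRH-column v))) (detDRH-staircaseColumn s b₁ ps v)
    alt-even : ∀ {z} → alt (2+ q) z ≈ z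
    alt-even {z} = trans (⁻¹-involutive (alt q z)) (alt-advance 0 ps z)

  detB≈wedge : ∀ blk → detB blk ≈ wedge (h₊ blk) (h₋ blk)
  detB≈wedge ((a , b) , (c , d)) =
    +-cong (*-congˡ (trans (+-identityʳ _) (*-identityʳ d)))
           (trans (+-identityʳ _) (-‿cong (*-congˡ (trans (+-identityʳ _) (*-identityʳ c)))))

  wedge-⋆ : ∀ x y blk → wedge (x ⋆ blk) (y ⋆ blk) ≈ wedge x y * detB blk
  wedge-⋆ (x₁ , x₂) (y₁ , y₂) blk@((a , b) , (c , d)) = trans
    (solve 8 (λ x₁ x₂ y₁ y₂ a b c d →
        (x₁ :* a :+ x₂ :* c) :* (y₁ :* b :+ y₂ :* d) :- (x₁ :* b :+ x₂ :* d) :* (y₁ :* a :+ y₂ :* c)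
        := (x₁ :* y₂ :- x₂ :* y₁) :* (a :* d :- b :* c))
      refl x₁ x₂ y₁ y₂ a b c d)
    (*-congˡ (sym (detB≈wedge blk)))

  wedge-turn : ∀ x y blk → wedge (turn x blk) (turn y blk) ≈ wedge x y * detB blk
  wedge-turn (x₁ , x₂) (y₁ , y₂) blk@((a , b) , (c , d)) = trans
    (solve 8 (λ x₁ x₂ y₁ y₂ a b c d →
        (:- (x₁ :* d :- x₂ :* c)) :* (y₁ :* b :- y₂ :* a) :- (x₁ :* b :- x₂ :* a) :* (:- (y₁ :* d :- y₂ :* c))
        := (x₁ :* y₂ :- x₂ :* y₁) :* (a :* d :- b :* c))
      refl x₁ x₂ y₁ y₂ a b c d)
    (*-congˡ (sym (detB≈wedge blk)))

  wedge-transfer : ∀ c b x y → wedge (transfer c b x) (transfer c b y) ≈ wedge x y * (detB c * detB b)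
  wedge-transfer c b x y = begin
    wedge (turn (x ⋆ c) b) (turn (y ⋆ c) b) ≈⟨ wedge-turn (x ⋆ c) (y ⋆ c) b ⟩
    wedge (x ⋆ c) (y ⋆ c) * detB b          ≈⟨ *-congʳ (wedge-⋆ x y c) ⟩
    wedge x y * detB c * detB b             ≈⟨ *-assoc _ _ _ ⟩
    wedge x y * (detB c * detB b)           ∎

  detProduct : List Block → Carrier
  detProduct = foldr (λ b acc → detB b * acc) 1#

  detProduct-∷ʳ : ∀ xs b → detProduct (xs ∷ʳ b) ≈ detProduct xs * detB b
  detProduct-∷ʳ []       b = trans (*-identityʳ _) (sym (*-identityˡ _))
  detProduct-∷ʳ (x ∷ xs) b = trans (*-congˡ (detProduct-∷ʳ xs b)) (sym (*-assoc _ _ _))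

  wedge-transferAll : ∀ x y ps → wedge (transferAll x ps) (transferAll y ps) ≈ wedge x y * detProduct (flatten ps)
  wedge-transferAll x y []            = sym (*-identityʳ _)
  wedge-transferAll x y ((c , b) ∷ ps) = begin
    wedge (transferAll (transfer c b x) ps) (transferAll (transfer c b y) ps)
      ≈⟨ wedge-transferAll (transfer c b x) (transfer c b y) ps ⟩
    wedge (transfer c b x) (transfer c b y) * detProduct (flatten ps)
      ≈⟨ *-congʳ (wedge-transfer c b x y) ⟩
    wedge x y * (detB c * detB b) * detProduct (flatten ps)
      ≈⟨ trans (*-assoc _ _ _) (*-congˡ (*-assoc _ _ _)) ⟩
    wedge x y * (detB c * (detB b * detProduct (flatten ps))) ∎

  wedge-h₋-⋆ : ∀ v blk → wedge (h₋ blk) (v ⋆ blk) ≈ - (proj₁ v * detB blk)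
  wedge-h₋-⋆ (v₁ , v₂) blk@((a , b) , (c , d)) = trans
    (solve 6 (λ v₁ v₂ a b c d → c :* (v₁ :* b :+ v₂ :* d) :- d :* (v₁ :* a :+ v₂ :* c) := :- (v₁ :* (a :* d :- b :* c)))
      refl v₁ v₂ a b c d)
    (-‿cong (*-congˡ (sym (detB≈wedge blk))))

  wedge-initial : ∀ s s̃ b₀ bw b₁ → h₋ bw ≈ₕ s →
    wedge (turn s b₁) (transfer bw b₁ (turn s̃ b₀)) ≈ - (detB (stack (h₋ b₀) s̃) * detB bw * detB b₁)
  wedge-initial s s̃@(t₁ , t₂) b₀@(_ , (a₁ , a₂)) bw b₁ h₋bw≈s = begin
    wedge (turn s b₁) (turn (turn s̃ b₀ ⋆ bw) b₁)          ≈⟨ wedge-turn s (turn s̃ b₀ ⋆ bw) b₁ ⟩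
    wedge s (turn s̃ b₀ ⋆ bw) * detB b₁                    ≈⟨ *-congʳ (wedge-cong (≈ₕ-sym h₋bw≈s) (refl , refl)) ⟩
    wedge (h₋ bw) (turn s̃ b₀ ⋆ bw) * detB b₁              ≈⟨ *-congʳ (wedge-h₋-⋆ (turn s̃ b₀) bw) ⟩
    - (- (t₁ * a₂ - t₂ * a₁) * detB bw) * detB b₁         ≈⟨ solve 6 (λ t₁ t₂ a₁ a₂ B B₁ →
                                                                  :- (:- (t₁ :* a₂ :- t₂ :* a₁) :* B) :* B₁
                                                                  := :- ((a₁ :* t₂ :- a₂ :* t₁) :* B :* B₁))
                                                               refl t₁ t₂ a₁ a₂ (detB bw) (detB b₁) ⟩
    - ((a₁ * t₂ - a₂ * t₁) * detB bw * detB b₁)           ≈⟨ -‿cong (*-congʳ (*-congʳ (sym (detB≈wedge (stack (h₋ b₀) s̃))))) ⟩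
    - (detB (stack (h₋ b₀) s̃) * detB bw * detB b₁)        ∎

  turn-exchange : ∀ A Ã e φ →
    (turn A e · φ) * wedge (h₊ e) Ã - wedge (h₊ e) A * (turn Ã e · φ) ≈ - (wedge A Ã * (detB e * proj₁ φ))
  turn-exchange (A₀ , A₁) (Ã₀ , Ã₁) e@((e₁₁ , e₁₂) , (e₂₁ , e₂₂)) (φ₁ , φ₂) = trans
    (solve 10 (λ A₀ A₁ Ã₀ Ã₁ e₁₁ e₁₂ e₂₁ e₂₂ φ₁ φ₂ →
        ((:- (A₀ :* e₂₂ :- A₁ :* e₂₁)) :* φ₁ :+ (A₀ :* e₁₂ :- A₁ :* e₁₁) :* φ₂) :* (e₁₁ :* Ã₁ :- e₁₂ :* Ã₀)
          :- (e₁₁ :* A₁ :- e₁₂ :* A₀) :* ((:- (Ã₀ :* e₂₂ :- Ã₁ :* e₂₁)) :* φ₁ :+ (Ã₀ :* e₁₂ :- Ã₁ :* e₁₁) :* φ₂)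
        := :- ((A₀ :* Ã₁ :- A₁ :* Ã₀) :* ((e₁₁ :* e₂₂ :- e₁₂ :* e₂₁) :* φ₁)))
      refl A₀ A₁ Ã₀ Ã₁ e₁₁ e₁₂ e₂₁ e₂₂ φ₁ φ₂)
    (-‿cong (*-congˡ (*-congʳ (sym (detB≈wedge e)))))

  staircase-identity : ∀ s s̃ f φ b₀ bw bw' b₁ ps bk → h₋ bw ≈ₕ s → h₊ bw' ≈ₕ f →
    detDRH (staircase s b₁ ps (bl bk ∷ bl bw' ∷ vd φ ∷ [])) * detDRH (staircase s̃ b₀ ((bw , b₁) ∷ ps) (bl bk ∷ hd f ∷ []))
    - detDRH (staircase s b₁ ps (bl bk ∷ hd f ∷ [])) * detDRH (staircase s̃ b₀ ((bw , b₁) ∷ ps) (bl bk ∷ bl bw' ∷ vd φ ∷ []))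
    ≈ detB (stack (h₋ b₀) s̃) * detB bw * detB bw' * proj₁ φ * detProduct (b₁ ∷ flatten ps ∷ʳ bk)
  staircase-identity s s̃ f φ b₀ bw bw' b₁ ps bk h₋bw≈s h₊bw'≈f = begin
    D₁ * D₂ - D₃ * D₄
      ≈⟨ +-cong (*-cong (withBlocks s b₁ ps) (withRow s̃ b₀ ((bw , b₁) ∷ ps)))
                (-‿cong (*-cong (withRow s b₁ ps) (withBlocks s̃ b₀ ((bw , b₁) ∷ ps)))) ⟩
    (turn A bw' · φ) * wedge (h₊ bw') Ã - wedge (h₊ bw') A * (turn Ã bw' · φ)
      ≈⟨ turn-exchange A Ã bw' φ ⟩
    - (wedge A Ã * (detB bw' * proj₁ φ))
      ≈⟨ -‿cong (*-congʳ (wedge-⋆ u ũ bk)) ⟩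
    - (wedge u ũ * detB bk * (detB bw' * proj₁ φ))
      ≈⟨ -‿cong (*-congʳ (*-congʳ (trans (wedge-transferAll (turn s b₁) (transfer bw b₁ (turn s̃ b₀)) ps)
                                         (*-congʳ (wedge-initial s s̃ b₀ bw b₁ h₋bw≈s))))) ⟩
    - (- (Δ * detB bw * detB b₁) * P * detB bk * (detB bw' * proj₁ φ))
      ≈⟨ solve 7 (λ Δ Bw Bw' φ₁ B₁ P Bk →
            :- (:- (Δ :* Bw :* B₁) :* P :* Bk :* (Bw' :* φ₁)) := Δ :* Bw :* Bw' :* φ₁ :* (B₁ :* (P :* Bk)))
          refl Δ (detB bw) (detB bw') (proj₁ φ) (detB b₁) P (detB bk) ⟩
    Δ * detB bw * detB bw' * proj₁ φ * (detB b₁ * (P * detB bk))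
      ≈⟨ *-congˡ (*-congˡ (detProduct-∷ʳ (flatten ps) bk)) ⟨
    Δ * detB bw * detB bw' * proj₁ φ * detProduct (b₁ ∷ flatten ps ∷ʳ bk) ∎
    where
    Δ = detB (stack (h₋ b₀) s̃)
    P = detProduct (flatten ps)
    D₁ = detDRH (staircase s b₁ ps (bl bk ∷ bl bw' ∷ vd φ ∷ []))
    D₂ = detDRH (staircase s̃ b₀ ((bw , b₁) ∷ ps) (bl bk ∷ hd f ∷ []))
    D₃ = detDRH (staircase s b₁ ps (bl bk ∷ hd f ∷ []))
    D₄ = detDRH (staircase s̃ b₀ ((bw , b₁) ∷ ps) (bl bk ∷ bl bw' ∷ vd φ ∷ []))
    u = staircaseVector s b₁ ps
    ũ = staircaseVector s̃ b₀ ((bw , b₁) ∷ ps)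
    A = u ⋆ bk
    Ã = ũ ⋆ bk
    withBlocks : ∀ s b₁ ps →
      detDRH (staircase s b₁ ps (bl bk ∷ bl bw' ∷ vd φ ∷ [])) ≈ turn (staircaseVector s b₁ ps ⋆ bk) bw' · φ
    withBlocks s b₁ ps = begin
      detDRH (staircase s b₁ ps (bl bk ∷ bl bw' ∷ vd φ ∷ []))   ≡⟨ ≡.cong detDRH (staircase-∷ʳ s b₁ ps bk bw' (vd φ ∷ [])) ⟨
      detDRH (staircase s b₁ (ps ∷ʳ (bk , bw')) (vd φ ∷ []))   ≈⟨ detDRH-staircaseColumn s b₁ (ps ∷ʳ (bk , bw')) φ ⟩
      staircaseVector s b₁ (ps ∷ʳ (bk , bw')) · φ             ≡⟨ ≡.cong (_· φ) (transferAll-∷ʳ (turn s b₁) ps bk bw') ⟩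
      turn (staircaseVector s b₁ ps ⋆ bk) bw' · φ             ∎
    withRow : ∀ s b₁ ps → detDRH (staircase s b₁ ps (bl bk ∷ hd f ∷ [])) ≈ wedge (h₊ bw') (staircaseVector s b₁ ps ⋆ bk)
    withRow s b₁ ps = trans (detDRH-staircaseRow s b₁ ps bk f) (wedge-cong (≈ₕ-sym h₊bw'≈f) (refl , refl))

  toList-odd : ∀ m (xs : Vec Block (suc (m ℕ.* 2))) → ∃[ ps ] ∃[ bk ] toList xs ≡ flatten ps ∷ʳ bk
  toList-odd zero    (bk ∷ [])         = [] , bk , ≡.refl
  toList-odd (suc m) (c ∷ b ∷ xs) with toList-odd m xs
  ... | ps , bk , xs≡ = (c , b) ∷ ps , bk , ≡.cong (λ l → c ∷ b ∷ l) xs≡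

  prodDet≡detProduct : ∀ {n} (xs : Vec Block n) → prodDet xs ≡ detProduct (toList xs)
  prodDet≡detProduct []       = ≡.refl
  prodDet≡detProduct (x ∷ xs) = ≡.cong (detB x *_) (prodDet≡detProduct xs)

corollary7p12 : ∀ {c ℓ} (R : CommutativeRing c ℓ) →
    let open CommutativeRing R in let open DRH R in
    (k : ℕ) → 0 < k → 2 ∣ k →
    (s s̃ f : HDom) (φ : VDom) (b₀ bw bw' : Block) (bs : Vec Block k) →
    h₋ bw ≈ₕ s → h₊ bw' ≈ₕ f →
    detDRH (hd s ∷ map bl (toList bs) ++ bl bw' ∷ vd φ ∷ [])
      * detDRH (hd s̃ ∷ bl b₀ ∷ bl bw ∷ map bl (toList bs) ++ hd f ∷ [])
    - detDRH (hd s ∷ map bl (toList bs) ++ hd f ∷ [])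
      * detDRH (hd s̃ ∷ bl b₀ ∷ bl bw ∷ map bl (toList bs) ++ bl bw' ∷ vd φ ∷ [])
    ≈ detB (stack (h₋ b₀) s̃) * detB bw * detB bw' * proj₁ φ * prodDet bs
corollary7p12 R .0 () (divides zero ≡.refl)
corollary7p12 R .(suc m ℕ.* 2) _ (divides (suc m) ≡.refl) s s̃ f φ b₀ bw bw' (b₁ ∷ rest) h₋bw≈s h₊bw'≈f
  with Staircase.toList-odd R m rest
... | ps , bk , toList≡
  rewrite Staircase.prodDet≡detProduct R rest | toList≡
        | Staircase.map-flatten-∷ʳ R ps bk (DRH.bl bw' ∷ DRH.vd φ ∷ [])
        | Staircase.map-flatten-∷ʳ R ps bk (DRH.hd f ∷ [])
  = Staircase.staircase-identity R s s̃ f φ b₀ bw bw' b₁ ps bk h₋bw≈s h₊bw'≈f
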